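{- (1) Let $\sigma$ be an atomic spatial formula, $s$ a store and $h$ a heap such that $s,h\models\sigma$, $(a,b)\in\mathrm{Ran}(h)$ and $a\notin\mathrm{Dom}(h)\cup\{s(t)\mid t\in\mathrm{Tm}(\sigma)\}$. Then $\sigma$ is an array atomic formula $\mathrm{Arr}(t,u)$. (2) Let $\Sigma$ be a spatial formula, $s$ a store and $h,h'$ heaps such that $s,h\models\Sigma$, $h(d)=(a,b)$, $a\notin\mathrm{Dom}(h)\cup\{s(t)\mid t\in\mathrm{Tm}(\Sigma)\}$, and $h'\sim_d h$. Then $s,h'\models\Sigma$.
   Context: Terms $t::=x\mid0\mid1\mid\cdots\mid t+t$ are interpreted in $N$ by a store $s$. A heap is a finite partial function from $N\setminus\{0\}$ to $N^2$; $\mathrm{Ran}(h)$ is its set of values. Spatial formulas: $\Sigma::=\mathrm{Emp}\mid t\mapsto(t,t)\mid\mathrm{Arr}(t,t)\mid\mathrm{ls}(t,t)\mid\mathrm{dll}(t,t,t,t)\mid\Sigma*\Sigma$; atomic ones are those other than $*$-compositions. Satisfaction: $s,h\models\mathrm{Emp}$ iff $\mathrm{Dom}(h)=\emptyset$; $s,h\models t\mapsto(u,v)$ iff $\mathrm{Dom}(h)=\{s(t)\}$ and $h(s(t))=(s(u),s(v))$; $s,h\models\mathrm{Arr}(t,u)$ iff $s(t)\le s(u)$ and $\mathrm{Dom}(h)=\{x\mid s(t)\le x\le s(u)\}$; $s,h\models\Sigma_1*\Sigma_2$ iff $h=h_1+h_2$ (disjoint) with $s,h_i\models\Sigma_i$;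 $s,h\models\mathrm{ls}(t,u)$ iff $s,h\models\mathrm{ls}^k(t,u)$ for some $k$, and similarly for $\mathrm{dll}$, where $\mathrm{ls}^0,\mathrm{dll}^0$ are unsatisfiable, $\mathrm{ls}^{k+1}(t,u)=(t=u\land\mathrm{Emp})\lor\exists zw(t\mapsto(z,w)*\mathrm{ls}^k(z,u))$, $\mathrm{dll}^{k+1}(t,u,v,w)=(t=u\land v=w\land\mathrm{Emp})\lor\exists z(t\mapsto(z,w)*\mathrm{dll}^k(z,u,v,t))$. $\mathrm{Tm}(\Sigma)$ is the set of terms in $\Sigma$: $\mathrm{Tm}(\mathrm{Emp})=\emptyset$, $\mathrm{Tm}(t\mapsto(u_1,u_2))=\{t,u_1,u_2\}$, $\mathrm{Tm}(\mathrm{Arr}(t,u))=\{t,u\}$, $\mathrm{Tm}(\mathrm{ls}(t,u))=\{t,u\}$, $\mathrm{Tm}(\mathrm{dll}(t,u,v,w))=\{t,u,v,w\}$, $\mathrm{Tm}(\Sigma_1*\Sigma_2)=\mathrm{Tm}(\Sigma_1)\cup\mathrm{Tm}(\Sigma_2)$. For heaps $h,h'$ and $d\in N$, $h'\sim_d h$ means $\mathrm{Dom}(h')=\mathrm{Dom}(h)$ and $h'(x)=h(x)$ for all $x\in\mathrm{Dom}(h)\setminus\{d\}$. -}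

module Defs where

open import Data.Nat using (ℕ; zero; suc; _+_; _≤_)
open import Data.Product using (Σ; ∃; ∃-syntax; _×_; _,_)
open import Data.Sum using (_⊎_)
open import Data.Maybe using (Maybe; just; nothing)
open import Data.List using (List; []; _∷_; _++_)
open import Relation.Binary.PropositionalEquality using (_≡_; _≢_)
open import Relation.Nullary using (¬_)
open import Data.Empty using (⊥)
open import Data.Unit using (⊤)

Var : Set
Var = ℕ

data Term : Set where
  var  : Var → Term
  num  : ℕ → Term
  _⊕_  : Term → Term → Term

Store : Set
Store = Var → ℕ

⟦_⟧ : Term → Store → ℕ
⟦ var x ⟧ s = s x
⟦ num n ⟧ s = n
⟦ t ⊕ u ⟧ s = ⟦ t ⟧ s + ⟦ u ⟧ s

record Heap : Set where
  field
    fun      : ℕ → Maybe (ℕ × ℕ)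
    undef-0  : fun 0 ≡ nothing
    finite   : ∃[ n ] (∀ x → n ≤ x → fun x ≡ nothing)
open Heap public

InDom : Heap → ℕ → Set
InDom h x = ∃[ v ] (fun h x ≡ just v)

InRan : Heap → ℕ × ℕ → Set
InRan h p = ∃[ x ] (fun h x ≡ just p)

DisjSum : Heap → Heap → Heap → Set
DisjSum h h₁ h₂ = ∀ x →
  (fun h₁ x ≡ nothing × fun h x ≡ fun h₂ x) ⊎ (fun h₂ x ≡ nothing × fun h x ≡ fun h₁ x)

EmpH : Heap → Set
EmpH h = ∀ x → fun h x ≡ nothing

PointsH : ℕ → ℕ → ℕ → Heap → Set
PointsH x u v h = fun h x ≡ just (u , v) × (∀ y → InDom h y → y ≡ x)

lsK : ℕ → ℕ → ℕ → Heap → Set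
lsK zero    x y h = ⊥
lsK (suc k) x y h =
  (x ≡ y × EmpH h) ⊎
  (∃[ z ] ∃[ w ] ∃[ h₁ ] ∃[ h₂ ] (DisjSum h h₁ h₂ × PointsH x z w h₁ × lsK k z y h₂))

dllK : ℕ → ℕ → ℕ → ℕ → ℕ → Heap → Set
dllK zero    t u v w h = ⊥
dllK (suc k) t u v w h =
  (t ≡ u × v ≡ w × EmpH h) ⊎
  (∃[ z ] ∃[ h₁ ] ∃[ h₂ ] (DisjSum h h₁ h₂ × PointsH t z w h₁ × dllK k z u v t h₂))

data Spatial : Set where
  Emp  : Spatial
  _↦⟨_,_⟩ : Term → Term → Term → Spatial
  Arr  : Term → Term → Spatial
  ls   : Term → Term → Spatial
  dll  : Term → Term → Term → Term → Spatial
  _✱_  : Spatial → Spatial → Spatial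

IsAtomic : Spatial → Set
IsAtomic (σ ✱ τ) = ⊥
IsAtomic _       = ⊤

_,_⊨_ : Store → Heap → Spatial → Set
s , h ⊨ Emp = EmpH h
s , h ⊨ (t ↦⟨ u , v ⟩) = PointsH (⟦ t ⟧ s) (⟦ u ⟧ s) (⟦ v ⟧ s) h
s , h ⊨ Arr t u = ⟦ t ⟧ s ≤ ⟦ u ⟧ s ×
                  (∀ x → InDom h x → (⟦ t ⟧ s ≤ x × x ≤ ⟦ u ⟧ s)) ×
                  (∀ x → ⟦ t ⟧ s ≤ x → x ≤ ⟦ u ⟧ s → InDom h x)
s , h ⊨ ls t u = ∃[ k ] lsK k (⟦ t ⟧ s) (⟦ u ⟧ s) h
s , h ⊨ dll t u v w = ∃[ k ] dllK k (⟦ t ⟧ s) (⟦ u ⟧ s) (⟦ v ⟧ s) (⟦ w ⟧ s) h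
s , h ⊨ (σ ✱ τ) = ∃[ h₁ ] ∃[ h₂ ] (DisjSum h h₁ h₂ × s , h₁ ⊨ σ × s , h₂ ⊨ τ)

Tm : Spatial → List Term
Tm Emp = []
Tm (t ↦⟨ u , v ⟩) = t ∷ u ∷ v ∷ []
Tm (Arr t u) = t ∷ u ∷ []
Tm (ls t u) = t ∷ u ∷ []
Tm (dll t u v w) = t ∷ u ∷ v ∷ w ∷ []
Tm (σ ✱ τ) = Tm σ ++ Tm τ

Sim : ℕ → Heap → Heap → Set
Sim d h' h = (∀ x → (InDom h' x → InDom h x) × (InDom h x → InDom h' x)) ×
             (∀ x → InDom h x → x ≢ d → fun h' x ≡ fun h x)

module Submission where

-- (1) Call a heap h "list-shaped from x to y" when x is allocated in h or
--     equals y, and the first field of every cell of h is allocated in h or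
--     equals y.  Every ls-heap and every dll-heap is list-shaped from its start
--     to its end (induction on the unfolding depth, one cons cell at a time).
--     So in an Emp, points-to, ls or dll heap, the first field of a cell is
--     allocated or is the value of a term of the formula; only an array can
--     hold a cell whose first field is a "fresh" dangling address a.
--
-- (2) By induction on Σ, generalised to the hypothesis "if d is allocated in h
--     then the first field of h(d) is a", which is inherited by sub-heaps:
--     * Arr only constrains the domain, which h' ∼_d h preserves;
--     * for any other atom, d is unallocated by (1), so h' = h pointwise and
--       satisfaction is invariant under pointwise-equal heaps;
--     * for σ ✱ τ, split h' by restricting it to the domains of the two parts.

open import Defs
open import Data.Nat using (ℕ; suc)
open import Data.Maybe using (Maybe; just; nothing)
open import Data.Maybe.Properties using (just-injective)
open import Data.Product using (∃-syntax; _×_; _,_; proj₁; proj₂)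
open import Data.Sum using (_⊎_; inj₁; inj₂)
open import Data.Empty using (⊥-elim)
open import Data.List.Membership.Propositional using (_∈_)
open import Data.List.Membership.Propositional.Properties using (∈-++⁺ˡ; ∈-++⁺ʳ)
open import Data.List.Relation.Unary.Any using (here; there)
open import Relation.Binary.PropositionalEquality
open import Relation.Nullary using (¬_)

nothing≢just : ∀ {A : Set} {v : A} → nothing ≢ just v
nothing≢just ()

record _⊑_ (g h : Heap) : Set where
  constructor ⊑-intro
  field ⊑-cell : ∀ x {v} → fun g x ≡ just v → fun h x ≡ just v
open _⊑_

⊑-dom : ∀ {g h} → g ⊑ h → ∀ x → InDom g x → InDom h x
⊑-dom g⊑h x (v , e) = v , ⊑-cell g⊑h x e

sum-⊑ˡ : ∀ h h₁ h₂ → DisjSum h h₁ h₂ → h₁ ⊑ h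
sum-⊑ˡ h h₁ h₂ D = ⊑-intro cell
  where
  cell : ∀ x {v} → fun h₁ x ≡ just v → fun h x ≡ just v
  cell x e with D x
  ... | inj₁ (h₁x≡nothing , _) = ⊥-elim (nothing≢just (trans (sym h₁x≡nothing) e))
  ... | inj₂ (_ , hx≡h₁x)     = trans hx≡h₁x e

sum-⊑ʳ : ∀ h h₁ h₂ → DisjSum h h₁ h₂ → h₂ ⊑ h
sum-⊑ʳ h h₁ h₂ D = ⊑-intro cell
  where
  cell : ∀ x {v} → fun h₂ x ≡ just v → fun h x ≡ just v
  cell x e with D x
  ... | inj₁ (_ , hx≡h₂x)     = trans hx≡h₂x e
  ... | inj₂ (h₂x≡nothing , _) = ⊥-elim (nothing≢just (trans (sym h₂x≡nothing) e))

sum-cell : ∀ h h₁ h₂ x {v} → DisjSum h h₁ h₂ → fun h x ≡ just v →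
           fun h₁ x ≡ just v ⊎ fun h₂ x ≡ just v
sum-cell h h₁ h₂ x D e with D x
... | inj₁ (_ , hx≡h₂x) = inj₂ (trans (sym hx≡h₂x) e)
... | inj₂ (_ , hx≡h₁x) = inj₁ (trans (sym hx≡h₁x) e)

points-cell : ∀ {x u v w} h p → PointsH x u v h → fun h p ≡ just w → w ≡ (u , v)
points-cell h p (hx≡uv , dom≡x) e with dom≡x p (_ , e)
... | refl = just-injective (trans (sym e) hx≡uv)

data AllocOrEnd (h : Heap) (y x : ℕ) : Set where
  allocated : InDom h x → AllocOrEnd h y x
  isEnd     : x ≡ y → AllocOrEnd h y x

record ListShaped (h : Heap) (x y : ℕ) : Set where
  field
    start : AllocOrEnd h y x
    next  : ∀ p {a b} → fun h p ≡ just (a , b) → AllocOrEnd h y a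
open ListShaped

allocOrEnd-⊑ : ∀ {g h y x} → g ⊑ h → AllocOrEnd g y x → AllocOrEnd h y x
allocOrEnd-⊑ {x = x} g⊑h (allocated x∈g) = allocated (⊑-dom g⊑h x x∈g)
allocOrEnd-⊑ g⊑h (isEnd x≡y) = isEnd x≡y

listShaped-emp : ∀ {h x y} → x ≡ y → EmpH h → ListShaped h x y
listShaped-emp x≡y emp = record
  { start = isEnd x≡y
  ; next  = λ p e → ⊥-elim (nothing≢just (trans (sym (emp p)) e))
  }

listShaped-cons : ∀ {h h₁ h₂ x z w y} → DisjSum h h₁ h₂ → PointsH x z w h₁ →
                  ListShaped h₂ z y → ListShaped h x y
listShaped-cons {h} {h₁} {h₂} {x} {y = y} D cell rest = record
  { start = allocated (⊑-dom (sum-⊑ˡ h h₁ h₂ D) x (_ , proj₁ cell))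
  ; next  = next′
  }
  where
  h₂⊑h : h₂ ⊑ h
  h₂⊑h = sum-⊑ʳ h h₁ h₂ D
  next′ : ∀ p {a b} → fun h p ≡ just (a , b) → AllocOrEnd h y a
  next′ p e with sum-cell h h₁ h₂ p D e
  ... | inj₁ e₁ with points-cell h₁ p cell e₁
  ...   | refl = allocOrEnd-⊑ h₂⊑h (start rest)
  next′ p e | inj₂ e₂ = allocOrEnd-⊑ h₂⊑h (next rest p e₂)

lsK-listShaped : ∀ k {x y h} → lsK k x y h → ListShaped h x y
lsK-listShaped (suc k) (inj₁ (x≡y , emp)) = listShaped-emp x≡y emp
lsK-listShaped (suc k) (inj₂ (_ , _ , h₁ , _ , D , cell , rest)) =
  listShaped-cons {h₁ = h₁} D cell (lsK-listShaped k rest)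

dllK-listShaped : ∀ k {t u v w h} → dllK k t u v w h → ListShaped h t u
dllK-listShaped (suc k) (inj₁ (t≡u , _ , emp)) = listShaped-emp t≡u emp
dllK-listShaped (suc k) (inj₂ (_ , h₁ , _ , D , cell , rest)) =
  listShaped-cons {h₁ = h₁} D cell (dllK-listShaped k rest)

dangling⇒array : ∀ (σ : Spatial) (s : Store) (h : Heap) (a b : ℕ) →
  IsAtomic σ → s , h ⊨ σ → InRan h (a , b) →
  ¬ InDom h a → (∀ t → t ∈ Tm σ → ⟦ t ⟧ s ≢ a) →
  ∃[ t ] ∃[ u ] (σ ≡ Arr t u)
dangling⇒array Emp s h a b _ emp (p , e) _ _ =
  ⊥-elim (nothing≢just (trans (sym (emp p)) e))
dangling⇒array (t ↦⟨ u , v ⟩) s h a b _ cell (p , e) _ fresh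
  with points-cell h p cell e
... | refl = ⊥-elim (fresh u (there (here refl)) refl)
dangling⇒array (Arr t u) s h a b _ _ _ _ _ = t , u , refl
dangling⇒array (ls t u) s h a b _ (k , L) (p , e) a∉h fresh
  with next (lsK-listShaped k L) p e
... | allocated a∈h = ⊥-elim (a∉h a∈h)
... | isEnd a≡u = ⊥-elim (fresh u (there (here refl)) (sym a≡u))
dangling⇒array (dll t u v w) s h a b _ (k , L) (p , e) a∉h fresh
  with next (dllK-listShaped k L) p e
... | allocated a∈h = ⊥-elim (a∉h a∈h)
... | isEnd a≡u = ⊥-elim (fresh u (there (here refl)) (sym a≡u))

record SameCells (h h' : Heap) : Set where
  constructor same-cells
  field same-at : ∀ x → fun h x ≡ fun h' x
open SameCells

sameCells-⊑ : ∀ {h h'} → SameCells h h' → h ⊑ h'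
sameCells-⊑ same = ⊑-intro λ x e → trans (sym (same-at same x)) e

sameCells-sym : ∀ {h h'} → SameCells h h' → SameCells h' h
sameCells-sym same = same-cells λ x → sym (same-at same x)

sameCells-emp : ∀ {h h'} → SameCells h h' → EmpH h → EmpH h'
sameCells-emp same emp x = trans (sym (same-at same x)) (emp x)

sum-sameCells : ∀ {h h'} h₁ h₂ → SameCells h h' → DisjSum h h₁ h₂ → DisjSum h' h₁ h₂
sum-sameCells h₁ h₂ same D x with D x
... | inj₁ (h₁x≡nothing , e) = inj₁ (h₁x≡nothing , trans (sym (same-at same x)) e)
... | inj₂ (h₂x≡nothing , e) = inj₂ (h₂x≡nothing , trans (sym (same-at same x)) e)

-- Only the top-level splitting (or emptiness) of h is mentioned by ⊨.
⊨-sameCells : ∀ Σ' {s h h'} → SameCells h h' → s , h ⊨ Σ' → s , h' ⊨ Σ'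
⊨-sameCells Emp same emp = sameCells-emp same emp
⊨-sameCells (t ↦⟨ u , v ⟩) same (hx≡uv , dom≡x) =
  ⊑-cell (sameCells-⊑ same) _ hx≡uv ,
  λ y y∈h' → dom≡x y (⊑-dom (sameCells-⊑ (sameCells-sym same)) y y∈h')
⊨-sameCells (Arr t u) same (t≤u , inside , covered) =
  t≤u , (λ x x∈h' → inside x (⊑-dom (sameCells-⊑ (sameCells-sym same)) x x∈h')) ,
  λ x l r → ⊑-dom (sameCells-⊑ same) x (covered x l r)
⊨-sameCells (ls t u) same (suc k , inj₁ (x≡y , emp)) =
  suc k , inj₁ (x≡y , sameCells-emp same emp)
⊨-sameCells (ls t u) same (suc k , inj₂ (z , w , h₁ , h₂ , D , cell , rest)) =
  suc k , inj₂ (z , w , h₁ , h₂ , sum-sameCells h₁ h₂ same D , cell , rest)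
⊨-sameCells (dll t u v w) same (suc k , inj₁ (t≡u , v≡w , emp)) =
  suc k , inj₁ (t≡u , v≡w , sameCells-emp same emp)
⊨-sameCells (dll t u v w) same (suc k , inj₂ (z , h₁ , h₂ , D , cell , rest)) =
  suc k , inj₂ (z , h₁ , h₂ , sum-sameCells h₁ h₂ same D , cell , rest)
⊨-sameCells (σ ✱ τ) same (h₁ , h₂ , D , S₁ , S₂) = h₁ , h₂ , sum-sameCells h₁ h₂ same D , S₁ , S₂

sim-unallocated : ∀ d h h' → Sim d h' h → ∀ {x} → fun h x ≡ nothing → fun h' x ≡ nothing
sim-unallocated d h h' sim {x} hx≡nothing with fun h' x in e
... | nothing = refl
... | just w  = ⊥-elim (nothing≢just (trans (sym hx≡nothing) (proj₂ (proj₁ (proj₁ sim x) (w , e)))))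

sim-sameCells : ∀ d h h' → Sim d h' h → fun h d ≡ nothing → SameCells h h'
sim-sameCells d h h' sim hd≡nothing = same-cells same
  where
  same : ∀ x → fun h x ≡ fun h' x
  same x with fun h x in e
  ... | nothing = sym (sim-unallocated d h h' sim e)
  ... | just v  = sym (trans (proj₂ sim x (v , e) x≢d) e)
    where
    x≢d : x ≢ d
    x≢d refl = nothing≢just (trans (sym hd≡nothing) e)

mask : ∀ {A B : Set} → Maybe A → Maybe B → Maybe B
mask nothing  _ = nothing
mask (just _) m = m

mask-nothing : ∀ {A B : Set} {m : Maybe A} (n : Maybe B) → m ≡ nothing → mask m n ≡ nothing
mask-nothing n refl = refl

mask-just : ∀ {A B : Set} {m : Maybe A} {v : A} (n : Maybe B) → m ≡ just v → mask m n ≡ n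
mask-just n refl = refl

restrict : Heap → Heap → Heap
restrict g h' = record
  { fun     = λ x → mask (fun g x) (fun h' x)
  ; undef-0 = mask-nothing (fun h' 0) (undef-0 g)
  ; finite  = proj₁ (finite g) , λ x n≤x → mask-nothing (fun h' x) (proj₂ (finite g) x n≤x)
  }

restrict-agree : ∀ h h' g x → (fun h x ≡ nothing → fun h' x ≡ nothing) →
                 fun h x ≡ fun g x → fun h' x ≡ fun (restrict g h') x
restrict-agree h h' g x dom⊆ hx≡gx with fun g x
... | nothing = dom⊆ hx≡gx
... | just _  = refl

sum-restrict : ∀ h h' h₁ h₂ → (∀ {x} → fun h x ≡ nothing → fun h' x ≡ nothing) →
               DisjSum h h₁ h₂ → DisjSum h' (restrict h₁ h') (restrict h₂ h')
sum-restrict h h' h₁ h₂ dom⊆ D x with D x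
... | inj₁ (h₁x≡nothing , hx≡h₂x) =
  inj₁ (mask-nothing (fun h' x) h₁x≡nothing , restrict-agree h h' h₂ x dom⊆ hx≡h₂x)
... | inj₂ (h₂x≡nothing , hx≡h₁x) =
  inj₂ (mask-nothing (fun h' x) h₂x≡nothing , restrict-agree h h' h₁ x dom⊆ hx≡h₁x)

sim-restrict : ∀ d h h' g → Sim d h' h → g ⊑ h → Sim d (restrict g h') g
sim-restrict d h h' g sim g⊑h = (λ x → to x , from x) , agree
  where
  to : ∀ x → InDom (restrict g h') x → InDom g x
  to x (w , e) with fun g x
  ... | just v  = v , refl
  ... | nothing = ⊥-elim (nothing≢just e)
  from : ∀ x → InDom g x → InDom (restrict g h') x
  from x (v , gx≡v) with proj₂ (proj₁ sim x) (v , ⊑-cell g⊑h x gx≡v)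
  ... | w , h'x≡w = w , trans (mask-just (fun h' x) gx≡v) h'x≡w
  agree : ∀ x → InDom g x → x ≢ d → fun (restrict g h') x ≡ fun g x
  agree x (v , gx≡v) x≢d = begin
    fun (restrict g h') x ≡⟨ mask-just (fun h' x) gx≡v ⟩
    fun h' x              ≡⟨ proj₂ sim x (v , ⊑-cell g⊑h x gx≡v) x≢d ⟩
    fun h x               ≡⟨ ⊑-cell g⊑h x gx≡v ⟩
    just v                ≡⟨ sym gx≡v ⟩
    fun g x               ∎
    where open ≡-Reasoning

FirstFieldAt : Heap → ℕ → ℕ → Set
FirstFieldAt h d a = ∀ {a' b'} → fun h d ≡ just (a' , b') → a' ≡ a

firstField-⊑ : ∀ {g h} d a → g ⊑ h → FirstFieldAt h d a → FirstFieldAt g d a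
firstField-⊑ d a g⊑h firstField e = firstField (⊑-cell g⊑h d e)

-- Any atom other than an array: d cannot hold a dangling cell, so h' = h.
atom-preserved : ∀ σ → IsAtomic σ → (∀ t u → σ ≢ Arr t u) → ∀ s h h' d a →
  s , h ⊨ σ → FirstFieldAt h d a →
  ¬ InDom h a → (∀ t → t ∈ Tm σ → ⟦ t ⟧ s ≢ a) → Sim d h' h → s , h' ⊨ σ
atom-preserved σ atomic notArr s h h' d a S firstField a∉h fresh sim =
  by-cell (fun h d) refl
  where
  by-cell : ∀ m → fun h d ≡ m → s , h' ⊨ σ
  by-cell nothing          hd≡nothing = ⊨-sameCells σ (sim-sameCells d h h' sim hd≡nothing) S
  by-cell (just (a' , b')) hd≡a'b' with firstField hd≡a'b'
  ... | refl with dangling⇒array σ s h a' b' atomic S (d , hd≡a'b') a∉h fresh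
  ...   | t , u , σ≡arr = ⊥-elim (notArr t u σ≡arr)

sim-preserves : ∀ (Σ' : Spatial) s h h' d a → s , h ⊨ Σ' → FirstFieldAt h d a →
  ¬ InDom h a → (∀ t → t ∈ Tm Σ' → ⟦ t ⟧ s ≢ a) → Sim d h' h → s , h' ⊨ Σ'
sim-preserves Emp            = atom-preserved Emp _ (λ _ _ ())
sim-preserves (t ↦⟨ u , v ⟩) = atom-preserved (t ↦⟨ u , v ⟩) _ (λ _ _ ())
sim-preserves (ls t u)       = atom-preserved (ls t u) _ (λ _ _ ())
sim-preserves (dll t u v w)  = atom-preserved (dll t u v w) _ (λ _ _ ())
sim-preserves (Arr t u) s h h' d a (t≤u , inside , covered) _ _ _ sim =
  t≤u , (λ x x∈h' → inside x (proj₁ (proj₁ sim x) x∈h')) ,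
  λ x l r → proj₂ (proj₁ sim x) (covered x l r)
sim-preserves (σ ✱ τ) s h h' d a (h₁ , h₂ , D , S₁ , S₂) firstField a∉h fresh sim =
  restrict h₁ h' , restrict h₂ h' , sum-restrict h h' h₁ h₂ (sim-unallocated d h h' sim) D ,
  sim-preserves σ s h₁ _ d a S₁ (firstField-⊑ d a h₁⊑h firstField) (λ a∈ → a∉h (⊑-dom h₁⊑h a a∈))
    (λ t t∈ → fresh t (∈-++⁺ˡ t∈)) (sim-restrict d h h' h₁ sim h₁⊑h) ,
  sim-preserves τ s h₂ _ d a S₂ (firstField-⊑ d a h₂⊑h firstField) (λ a∈ → a∉h (⊑-dom h₂⊑h a a∈))
    (λ t t∈ → fresh t (∈-++⁺ʳ (Tm σ) t∈)) (sim-restrict d h h' h₂ sim h₂⊑h)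
  where
  h₁⊑h : h₁ ⊑ h
  h₁⊑h = sum-⊑ˡ h h₁ h₂ D
  h₂⊑h : h₂ ⊑ h
  h₂⊑h = sum-⊑ʳ h h₁ h₂ D

lemma7p4 : (∀ (σ : Spatial) (s : Store) (h : Heap) (a b : ℕ) →
    IsAtomic σ → s , h ⊨ σ → InRan h (a , b) →
    ¬ InDom h a → (∀ t → t ∈ Tm σ → ⟦ t ⟧ s ≢ a) →
    ∃[ t ] ∃[ u ] (σ ≡ Arr t u))
    ×
    (∀ (Σ' : Spatial) (s : Store) (h h' : Heap) (d a b : ℕ) →
    s , h ⊨ Σ' → fun h d ≡ just (a , b) →
    ¬ InDom h a → (∀ t → t ∈ Tm Σ' → ⟦ t ⟧ s ≢ a) →
    Sim d h' h → s , h' ⊨ Σ')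
lemma7p4 =
  dangling⇒array ,
  λ Σ' s h h' d a b S hd≡ab → sim-preserves Σ' s h h' d a S (firstField h d hd≡ab)
  where
  firstField : ∀ h d {a b} → fun h d ≡ just (a , b) → FirstFieldAt h d a
  firstField h d hd≡ab e = cong proj₁ (just-injective (trans (sym e) hd≡ab))
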